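{- For every $m\in\mathbb{N}$, $\gamma_{e,g}(K_m)=\left\lceil \tfrac{2}{3}m\right\rceil-1$, where $K_m$ is the complete graph on $m$ vertices. Equivalently, $\gamma_g(L(K_m))=\lceil 2m/3\rceil-1$.
   Context: All graphs are finite, simple and undirected. For an edge $e$ of a graph $G$, its closed edge neighborhood $N[e]$ consists of $e$ together with all edges sharing an endpoint with $e$. In the edge domination game on $G$, Dominator and Staller alternately choose edges, Dominator first; each chosen edge $s_i$ must satisfy $N[s_i]\setminus\bigcup_{j<i}N[s_j]\neq\emptyset$. The game ends when every edge lies in $\bigcup_j N[s_j]$. Dominator minimizes and Staller maximizes the number of chosen edges; $\gamma_{e,g}(G)$ is this number under optimal play, and it equals the game domination number $\gamma_g(L(G))$ of the line graph. -}

module Defs where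

open import Data.Bool using (Bool; true; false; not; _∧_; _∨_; if_then_else_)
open import Data.Nat using (ℕ; zero; suc; _+_; _*_; _∸_; _⊓_; _⊔_; _<?_; NonZero)
open import Data.Nat.DivMod using (_/_)
open import Data.Fin using (Fin; toℕ)
open import Data.Fin.Properties using () renaming (_≟_ to _≟ᶠ_)
open import Data.Bool.ListAction using (any)
open import Data.List using (List; []; _∷_; filter; map; length; allFin; concatMap; foldr)
open import Data.Product using (_×_; _,_; proj₁; proj₂)
open import Relation.Nullary.Decidable using (⌊_⌋; T?)
open import Relation.Binary.PropositionalEquality using (_≡_)
open import Data.Bool using (T)

record Graph : Set where
  field
    n       : ℕ
    adj     : Fin n → Fin n → Bool
    adj-sym : ∀ u v → adj u v ≡ adj v u
    adj-irr : ∀ u → adj u u ≡ false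
open Graph public

K : ℕ → Graph
K m = record
  { n = m
  ; adj = λ u v → not ⌊ u ≟ᶠ v ⌋
  ; adj-sym = sym'
  ; adj-irr = irr
  }
  where
  open import Relation.Binary.PropositionalEquality using (refl; sym)
  open import Relation.Nullary using (yes; no)
  sym' : ∀ (u v : Fin m) → not ⌊ u ≟ᶠ v ⌋ ≡ not ⌊ v ≟ᶠ u ⌋
  sym' u v with u ≟ᶠ v | v ≟ᶠ u
  ... | yes _ | yes _ = refl
  ... | no _  | no _  = refl
  ... | yes p | no q  = Data.Empty.⊥-elim (q (sym p)) where import Data.Empty
  ... | no p  | yes q = Data.Empty.⊥-elim (p (sym q)) where import Data.Empty
  irr : ∀ (u : Fin m) → not ⌊ u ≟ᶠ u ⌋ ≡ false
  irr u with u ≟ᶠ u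
  ... | yes _ = refl
  ... | no ¬p = Data.Empty.⊥-elim (¬p refl) where import Data.Empty

module _ (G : Graph) where
  Edge : Set
  Edge = Fin (n G) × Fin (n G)

  -- each edge {u,v} is listed once, as (u , v) with u < v
  edges : List Edge
  edges = filter (λ e → T? (⌊ toℕ (proj₁ e) <? toℕ (proj₂ e) ⌋ ∧ adj G (proj₁ e) (proj₂ e)))
                 (concatMap (λ u → map (λ v → (u , v)) (allFin (n G))) (allFin (n G)))

  eqV : Fin (n G) → Fin (n G) → Bool
  eqV u v = ⌊ u ≟ᶠ v ⌋

  inN : Edge → Edge → Bool
  inN (a , b) (c , d) = eqV a c ∨ eqV a d ∨ eqV b c ∨ eqV b d

  dominated : List Edge → Edge → Bool
  dominated S f = any (λ s → inN s f) S

  legal : List Edge → Edge → Bool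
  legal S e = any (λ f → inN e f ∧ not (dominated S f)) edges

  legalMoves : List Edge → List Edge
  legalMoves S = filter (λ e → T? (legal S e)) edges

  -- The fuel argument is the
  -- number of edges, which bounds the length of any game (each legal move
  -- dominates at least one new edge), so it never runs out prematurely.
  value : ℕ → Bool → List Edge → ℕ
  value zero    _   _ = 0
  value (suc k) dom S with map (λ e → value k (not dom) (e ∷ S)) (legalMoves S)
  ... | []     = 0
  ... | x ∷ xs = suc (if dom then foldr _⊓_ x xs else foldr _⊔_ x xs)

  γeg : ℕ
  γeg = value (length edges) true []

⌈_/3⌉ : ℕ → ℕ
⌈ a /3⌉ = (a + 2) / 3

-- In K_m an edge {c,d} is dominated exactly when c or d is an endpoint of a
-- chosen edge, so a position is described by the number n of uncovered
-- vertices. A move is legal iff n ≥ 2 and it touches an uncovered vertex, and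
-- it then covers two new vertices or one. Dominator can always cover two;
-- Staller can always cover just one, because after the first move some vertex
-- is covered. The value therefore depends only on n and on who moves, and the
-- resulting recurrence, started at n = m with Dominator to move, solves to
-- ⌈2m/3⌉ − 1.
module Submission where

open import Defs
open import Data.Nat
  using (ℕ; zero; suc; _+_; _*_; _∸_; _≥_; _≤_; _<_; z≤n; s≤s; s≤s⁻¹; _<?_; _⊓_; _⊔_)
open import Data.Nat.Properties
  using ( module ≤-Reasoning; ≤-refl; ≤-reflexive; ≤-trans; ≤-antisym; ≤⇒≯; <-irrefl; <-cmp
        ; n≤1+n; m≤m+n; +-cancelˡ-≡; m⊓n≤m; m⊓n≤n; ⊓-glb; m≤m⊔n; m≤n⊔m; ⊔-lub)
open import Data.Nat.DivMod using (_/_; m/n≡1+[m∸n]/n)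
open import Data.Nat.Tactic.RingSolver using (solve-∀)
open import Data.Bool using (Bool; true; false; not; _∧_; _∨_; if_then_else_; T)
open import Data.Bool.Properties using (T-∧; T-∨; T-≡; ∨-comm; ∨-zeroʳ)
open import Data.Bool.Solver using (module ∨-∧-Solver)
open import Data.Bool.ListAction using (any; or)
open import Data.Fin using (Fin; toℕ)
import Data.Fin as Fin
open import Data.Fin.Properties using (_≟_; toℕ-injective)
open import Data.List
  using (List; []; _∷_; foldr; map; allFin; filter; concatMap; concat; tabulate; length; _++_)
open import Data.List.Properties
  using (map-cong; filter-none; filter-all; filter-++; length-++; length-map; length-tabulate)
open import Data.List.Membership.Propositional using (_∈_; lose; find)
open import Data.List.Membership.Propositional.Properties
  using (∈-filter⁺; ∈-filter⁻; ∈-map⁺; ∈-concat⁺′; ∈-allFin)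
open import Data.List.Relation.Unary.Any using (here; there)
open import Data.List.Relation.Unary.Any.Properties using (any⁺; any⁻)
open import Data.List.Relation.Unary.All using (All; []; _∷_)
import Data.List.Relation.Unary.All as All
import Data.List.Relation.Unary.All.Properties as All
open import Data.Product using (_×_; _,_; proj₁; proj₂; ∃; ∃₂)
open import Data.Sum using (_⊎_; inj₁; inj₂)
open import Data.Empty using (⊥-elim)
open import Function using (_∘_)
open import Function.Bundles using (Equivalence)
open import Relation.Nullary using (¬_; yes; no)
open import Relation.Unary using (Decidable)
open import Relation.Nullary.Decidable using (⌊_⌋; T?; toWitness; fromWitness; toSum)
open import Relation.Binary.Definitions using (tri<; tri≈; tri>)
open import Relation.Binary.PropositionalEquality
  using (_≡_; _≢_; refl; sym; trans; cong; subst; ≡-≟-identity; ≢-≟-identity; module ≡-Reasoning)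

open Equivalence using (to; from)

T⊎T-not : ∀ x → T x ⊎ T (not x)
T⊎T-not true  = inj₁ _
T⊎T-not false = inj₂ _

T-not⇒¬T : ∀ {x} → T (not x) → ¬ T x
T-not⇒¬T {false} _ ()

T-not-∨ : ∀ {x y} → T (not x) → T (not y) → T (not (x ∨ y))
T-not-∨ {false} {false} _ _ = _

T-not-∨⁻ : ∀ x {y} → T (not (x ∨ y)) → T (not x) × T (not y)
T-not-∨⁻ false ny = _ , ny

count : ∀ {m} → (Fin m → Bool) → ℕ
count {zero}  P = 0
count {suc m} P = if P Fin.zero then suc (count (P ∘ Fin.suc)) else count (P ∘ Fin.suc)

count-cong : ∀ {m} {P Q : Fin m → Bool} → (∀ v → P v ≡ Q v) → count P ≡ count Q
count-cong {zero}          _    = refl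
count-cong {suc m} {P} {Q} P≗Q
  rewrite P≗Q Fin.zero | count-cong {P = P ∘ Fin.suc} {Q ∘ Fin.suc} (P≗Q ∘ Fin.suc) = refl

count-true : ∀ m → count {m} (λ _ → true) ≡ m
count-true zero    = refl
count-true (suc m) = cong suc (count-true m)

remove : ∀ {m} → Fin m → (Fin m → Bool) → Fin m → Bool
remove a P v = not ⌊ a ≟ v ⌋ ∧ P v

remove-self : ∀ {m} (P : Fin m → Bool) a → remove a P a ≡ false
remove-self P a rewrite ≡-≟-identity _≟_ {a} refl = refl

remove-other : ∀ {m} (P : Fin m → Bool) {a v} → a ≢ v → remove a P v ≡ P v
remove-other P a≢v rewrite ≢-≟-identity _≟_ a≢v = refl

remove-suc : ∀ {m} (P : Fin (suc m) → Bool) a v →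
             remove (Fin.suc a) P (Fin.suc v) ≡ remove a (P ∘ Fin.suc) v
remove-suc P a v with a ≟ v
... | yes _ = refl
... | no  _ = refl

remove⁺ : ∀ {m} (P : Fin m → Bool) {a b} → a ≢ b → T (P b) → T (remove a P b)
remove⁺ P a≢b Pb = subst T (sym (remove-other P a≢b)) Pb

remove⁻ : ∀ {m} {P : Fin m → Bool} {a b} → T (remove a P b) → a ≢ b × T (P b)
remove⁻ {a = a} {b} Qb with a ≟ b
... | no a≢b = a≢b , Qb

count-remove : ∀ {m} (P : Fin m → Bool) {a} → T (P a) → count P ≡ suc (count (remove a P))
count-remove P {Fin.zero} Pa with P Fin.zero
... | true = refl
count-remove P {Fin.suc a} Pa
  rewrite count-cong (remove-suc P a) | count-remove (P ∘ Fin.suc) Pa with P Fin.zero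
... | true  = refl
... | false = refl

count>0⇒∃ : ∀ {m} (P : Fin m → Bool) → 0 < count P → ∃ (T ∘ P)
count>0⇒∃ {suc m} P pos with P Fin.zero in Pzero
... | true  = Fin.zero , from T-≡ Pzero
... | false with count>0⇒∃ (P ∘ Fin.suc) pos
...   | a , Pa = Fin.suc a , Pa

count≥2⇒∃₂ : ∀ {m} (P : Fin m → Bool) → 2 ≤ count P → ∃₂ λ a b → a ≢ b × T (P a) × T (P b)
count≥2⇒∃₂ P 2≤ with count>0⇒∃ P (≤-trans (s≤s z≤n) 2≤)
... | a , Pa with count>0⇒∃ (remove a P) (s≤s⁻¹ (subst (2 ≤_) (count-remove P Pa) 2≤))
...   | b , Qb with remove⁻ {P = P} Qb
...     | a≢b , Pb = a , b , a≢b , Pa , Pb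

∃₂⇒count≥2 : ∀ {m} (P : Fin m → Bool) {a b} → a ≢ b → T (P a) → T (P b) → 2 ≤ count P
∃₂⇒count≥2 P {a} {b} a≢b Pa Pb
  rewrite count-remove P Pa | count-remove (remove a P) (remove⁺ P a≢b Pb) = s≤s (s≤s z≤n)

count-decrement : ∀ {m} (P Q : Fin m → Bool) {a} → T (P a) → Q a ≡ false →
                  (∀ {v} → a ≢ v → Q v ≡ P v) → count P ≡ suc (count Q)
count-decrement P Q {a} Pa Qa Q≗P = trans (count-remove P Pa) (cong suc (count-cong agree))
  where
  agree : ∀ v → remove a P v ≡ Q v
  agree v with a ≟ v
  ... | yes refl = sym Qa
  ... | no  a≢v  = sym (Q≗P a≢v)

inN-swapˡ : ∀ G a b f → inN G (a , b) f ≡ inN G (b , a) f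
inN-swapˡ G a b (c , d) = solve 4 (λ ac ad bc bd → ac :+ (ad :+ (bc :+ bd)) := bc :+ (bd :+ (ac :+ ad))) refl
  (eqV G a c) (eqV G a d) (eqV G b c) (eqV G b d)
  where open ∨-∧-Solver

inN-swapʳ : ∀ G e c d → inN G e (c , d) ≡ inN G e (d , c)
inN-swapʳ G (a , b) c d = solve 4 (λ ac ad bc bd → ac :+ (ad :+ (bc :+ bd)) := ad :+ (ac :+ (bd :+ bc))) refl
  (eqV G a c) (eqV G a d) (eqV G b c) (eqV G b d)
  where open ∨-∧-Solver

inN⁻ : ∀ G {a b c d} → T (inN G (a , b) (c , d)) → (a ≡ c ⊎ a ≡ d) ⊎ (b ≡ c ⊎ b ≡ d)
inN⁻ G {a} {b} {c} {d} t with to T-∨ t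
... | inj₁ ac = inj₁ (inj₁ (toWitness {a? = a ≟ c} ac))
... | inj₂ t′ with to T-∨ t′
...   | inj₁ ad = inj₁ (inj₂ (toWitness {a? = a ≟ d} ad))
...   | inj₂ t″ with to T-∨ t″
...     | inj₁ bc = inj₂ (inj₁ (toWitness {a? = b ≟ c} bc))
...     | inj₂ bd = inj₂ (inj₂ (toWitness {a? = b ≟ d} bd))

minimaxStep : Bool → List ℕ → ℕ
minimaxStep _     []       = 0
minimaxStep true  (x ∷ xs) = suc (foldr _⊓_ x xs)
minimaxStep false (x ∷ xs) = suc (foldr _⊔_ x xs)

value-unfold : ∀ G k dom S →
  value G (suc k) dom S ≡
  minimaxStep dom (map (λ e → value G k (not dom) (e ∷ S)) (legalMoves G S))
value-unfold G k dom S with map (λ e → value G k (not dom) (e ∷ S)) (legalMoves G S)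
... | []     = refl
... | x ∷ xs with dom
...   | true  = refl
...   | false = refl

foldr-⊓-≤ : ∀ {y} x xs → y ∈ x ∷ xs → foldr _⊓_ x xs ≤ y
foldr-⊓-≤ x []       (here refl)         = ≤-refl
foldr-⊓-≤ x (z ∷ zs) (there (here refl)) = m⊓n≤m z _
foldr-⊓-≤ x (z ∷ zs) (here refl)         = ≤-trans (m⊓n≤n z _) (foldr-⊓-≤ x zs (here refl))
foldr-⊓-≤ x (z ∷ zs) (there (there y∈))  = ≤-trans (m⊓n≤n z _) (foldr-⊓-≤ x zs (there y∈))

≤-foldr-⊓ : ∀ {c} x xs → All (c ≤_) (x ∷ xs) → c ≤ foldr _⊓_ x xs
≤-foldr-⊓ x []       (c≤x ∷ [])        = c≤x
≤-foldr-⊓ x (z ∷ zs) (c≤x ∷ c≤z ∷ c≤zs) = ⊓-glb c≤z (≤-foldr-⊓ x zs (c≤x ∷ c≤zs))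

≤-foldr-⊔ : ∀ {y} x xs → y ∈ x ∷ xs → y ≤ foldr _⊔_ x xs
≤-foldr-⊔ x []       (here refl)         = ≤-refl
≤-foldr-⊔ x (z ∷ zs) (there (here refl)) = m≤m⊔n z _
≤-foldr-⊔ x (z ∷ zs) (here refl)         = ≤-trans (≤-foldr-⊔ x zs (here refl)) (m≤n⊔m z _)
≤-foldr-⊔ x (z ∷ zs) (there (there y∈))  = ≤-trans (≤-foldr-⊔ x zs (there y∈)) (m≤n⊔m z _)

foldr-⊔-≤ : ∀ {c} x xs → All (_≤ c) (x ∷ xs) → foldr _⊔_ x xs ≤ c
foldr-⊔-≤ x []       (x≤c ∷ [])        = x≤c
foldr-⊔-≤ x (z ∷ zs) (x≤c ∷ z≤c ∷ zs≤c) = ⊔-lub z≤c (foldr-⊔-≤ x zs (x≤c ∷ zs≤c))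

minimaxStep-min : ∀ {c} ys → c ∈ ys → All (c ≤_) ys → minimaxStep true ys ≡ suc c
minimaxStep-min (x ∷ xs) c∈ c≤ = cong suc (≤-antisym (foldr-⊓-≤ x xs c∈) (≤-foldr-⊓ x xs c≤))

minimaxStep-max : ∀ {c} ys → c ∈ ys → All (_≤ c) ys → minimaxStep false ys ≡ suc c
minimaxStep-max (x ∷ xs) c∈ ≤c = cong suc (≤-antisym (foldr-⊔-≤ x xs ≤c) (≤-foldr-⊔ x xs c∈))

-- The game on K_m seen through the number n of uncovered vertices, with the
-- same fuel argument as `value`.
reducedValue : ℕ → Bool → ℕ → ℕ
reducedValue zero    _     _             = 0
reducedValue (suc k) _     zero          = 0
reducedValue (suc k) _     (suc zero)    = 0
reducedValue (suc k) true  (suc (suc n)) = suc (reducedValue k false n)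
reducedValue (suc k) false (suc (suc n)) = suc (reducedValue k true (suc n))

reducedValue-mono : ∀ k dom n → reducedValue k dom n ≤ reducedValue k dom (suc n)
reducedValue-mono zero    _     _             = z≤n
reducedValue-mono (suc k) _     zero          = z≤n
reducedValue-mono (suc k) _     (suc zero)    = z≤n
reducedValue-mono (suc k) true  (suc (suc n)) = s≤s (reducedValue-mono k false n)
reducedValue-mono (suc k) false (suc (suc n)) = s≤s (reducedValue-mono k true (suc n))

closedForm : Bool → ℕ → ℕ
closedForm true  n = ⌈ 2 * n /3⌉ ∸ 1
closedForm false n = 2 * n / 3

[3+n]/3≡1+n/3 : ∀ n → (3 + n) / 3 ≡ suc (n / 3)
[3+n]/3≡1+n/3 n = m/n≡1+[m∸n]/n {3 + n} (s≤s (s≤s (s≤s z≤n)))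

closedForm-Dominator : ∀ n → closedForm true (2 + n) ≡ suc (closedForm false n)
closedForm-Dominator n = begin
  (2 * (2 + n) + 2) / 3 ∸ 1 ≡⟨ cong (λ x → x / 3 ∸ 1) (arith n) ⟩
  (3 + (3 + 2 * n)) / 3 ∸ 1 ≡⟨ cong (_∸ 1) ([3+n]/3≡1+n/3 (3 + 2 * n)) ⟩
  (3 + 2 * n) / 3           ≡⟨ [3+n]/3≡1+n/3 (2 * n) ⟩
  suc (2 * n / 3)           ∎
  where
  open ≡-Reasoning
  arith : ∀ n → 2 * (2 + n) + 2 ≡ 3 + (3 + 2 * n)
  arith = solve-∀

closedForm-Staller : ∀ n → suc (closedForm true (1 + n)) ≡ closedForm false (2 + n)
closedForm-Staller n = begin
  suc ((2 * (1 + n) + 2) / 3 ∸ 1) ≡⟨ cong (λ x → suc (x / 3 ∸ 1)) (arith₁ n) ⟩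
  suc ((3 + (2 * n + 1)) / 3 ∸ 1) ≡⟨ cong (λ x → suc (x ∸ 1)) ([3+n]/3≡1+n/3 (2 * n + 1)) ⟩
  suc ((2 * n + 1) / 3)           ≡⟨ [3+n]/3≡1+n/3 (2 * n + 1) ⟨
  (3 + (2 * n + 1)) / 3           ≡⟨ cong (_/ 3) (arith₂ n) ⟨
  2 * (2 + n) / 3                 ∎
  where
  open ≡-Reasoning
  arith₁ : ∀ n → 2 * (1 + n) + 2 ≡ 3 + (2 * n + 1)
  arith₁ = solve-∀
  arith₂ : ∀ n → 2 * (2 + n) ≡ 3 + (2 * n + 1)
  arith₂ = solve-∀

reducedValue≡closedForm : ∀ k dom n → n ≤ suc k → reducedValue k dom n ≡ closedForm dom n
reducedValue≡closedForm zero    true  zero          _ = refl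
reducedValue≡closedForm zero    false zero          _ = refl
reducedValue≡closedForm zero    true  (suc zero)    _ = refl
reducedValue≡closedForm zero    false (suc zero)    _ = refl
reducedValue≡closedForm zero    _     (suc (suc n)) (s≤s ())
reducedValue≡closedForm (suc k) true  zero          _ = refl
reducedValue≡closedForm (suc k) false zero          _ = refl
reducedValue≡closedForm (suc k) true  (suc zero)    _ = refl
reducedValue≡closedForm (suc k) false (suc zero)    _ = refl
reducedValue≡closedForm (suc k) true  (suc (suc n)) (s≤s n<1+k) =
  trans (cong suc (reducedValue≡closedForm k false n (≤-trans (n≤1+n n) n<1+k)))
        (sym (closedForm-Dominator n))
reducedValue≡closedForm (suc k) false (suc (suc n)) (s≤s n<1+k) =
  trans (cong suc (reducedValue≡closedForm k true (suc n) n<1+k)) (closedForm-Staller n)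

module Complete (m : ℕ) where

  Move : Set
  Move = Edge (K m)

  covered : List Move → Fin m → Bool
  covered S v = any (λ s → eqV (K m) (proj₁ s) v ∨ eqV (K m) (proj₂ s) v) S

  uncovered : List Move → Fin m → Bool
  uncovered S v = not (covered S v)

  #uncovered : List Move → ℕ
  #uncovered S = count (uncovered S)

  dominated≡covered : ∀ S c d → dominated (K m) S (c , d) ≡ covered S c ∨ covered S d
  dominated≡covered []            c d = refl
  dominated≡covered ((a , b) ∷ S) c d =
    trans (cong (inN (K m) (a , b) (c , d) ∨_) (dominated≡covered S c d))
          (solve 6 (λ ac ad bc bd x y → (ac :+ (ad :+ (bc :+ bd))) :+ (x :+ y)
                                      := ((ac :+ bc) :+ x) :+ ((ad :+ bd) :+ y))
                 refl (eqV (K m) a c) (eqV (K m) a d) (eqV (K m) b c) (eqV (K m) b d)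
                 (covered S c) (covered S d))
    where open ∨-∧-Solver

  undominated⁺ : ∀ S {c d} → T (uncovered S c) → T (uncovered S d) →
                 T (not (dominated (K m) S (c , d)))
  undominated⁺ S {c} {d} uc ud =
    subst (T ∘ not) (sym (dominated≡covered S c d)) (T-not-∨ uc ud)

  undominated⁻ : ∀ S {c d} → T (not (dominated (K m) S (c , d))) →
                 T (uncovered S c) × T (uncovered S d)
  undominated⁻ S {c} {d} t = T-not-∨⁻ (covered S c) (subst (T ∘ not) (dominated≡covered S c d) t)

  covered-fst : ∀ S a b → T (covered ((a , b) ∷ S) a)
  covered-fst S a b rewrite ≡-≟-identity _≟_ {a} refl = _

  uncovered-fst : ∀ S a b → uncovered ((a , b) ∷ S) a ≡ false
  uncovered-fst S a b = cong not (to T-≡ (covered-fst S a b))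

  uncovered-snd : ∀ S a b → uncovered ((a , b) ∷ S) b ≡ false
  uncovered-snd S a b rewrite ≡-≟-identity _≟_ {b} refl | ∨-zeroʳ ⌊ a ≟ b ⌋ = refl

  uncovered-other : ∀ S {a b v} → a ≢ v → b ≢ v → uncovered ((a , b) ∷ S) v ≡ uncovered S v
  uncovered-other S a≢v b≢v rewrite ≢-≟-identity _≟_ a≢v | ≢-≟-identity _≟_ b≢v = refl

  #uncovered-swap : ∀ S a b → #uncovered ((a , b) ∷ S) ≡ #uncovered ((b , a) ∷ S)
  #uncovered-swap S a b =
    count-cong λ v → cong (λ x → not (x ∨ covered S v)) (∨-comm ⌊ a ≟ v ⌋ ⌊ b ≟ v ⌋)

  #uncovered-cover₂ : ∀ S {a b} → a ≢ b → T (uncovered S a) → T (uncovered S b) →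
                      #uncovered S ≡ 2 + #uncovered ((a , b) ∷ S)
  #uncovered-cover₂ S {a} {b} a≢b ua ub =
    trans (count-remove (uncovered S) ua)
          (cong suc (count-decrement (remove a (uncovered S)) (uncovered ((a , b) ∷ S))
                       (remove⁺ (uncovered S) a≢b ub) (uncovered-snd S a b) agree))
    where
    agree : ∀ {v} → b ≢ v → uncovered ((a , b) ∷ S) v ≡ remove a (uncovered S) v
    agree {v} b≢v with toSum (a ≟ v)
    ... | inj₁ refl = trans (uncovered-fst S a b) (sym (remove-self (uncovered S) a))
    ... | inj₂ a≢v  = trans (uncovered-other S a≢v b≢v) (sym (remove-other (uncovered S) a≢v))

  #uncovered-cover₁ : ∀ S {a b} → T (uncovered S a) → T (covered S b) →
                      #uncovered S ≡ 1 + #uncovered ((a , b) ∷ S)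
  #uncovered-cover₁ S {a} {b} ua cb =
    count-decrement (uncovered S) (uncovered ((a , b) ∷ S)) ua (uncovered-fst S a b) agree
    where
    agree : ∀ {v} → a ≢ v → uncovered ((a , b) ∷ S) v ≡ uncovered S v
    agree {v} a≢v with toSum (b ≟ v)
    ... | inj₁ refl = trans (uncovered-snd S a b) (sym (cong not (to T-≡ cb)))
    ... | inj₂ b≢v  = uncovered-other S a≢v b≢v

  adj-K : ∀ {c d : Fin m} → c ≢ d → T (adj (K m) c d)
  adj-K c≢d rewrite ≢-≟-identity _≟_ c≢d = _

  isEdge : Move → Bool
  isEdge (c , d) = ⌊ toℕ c <? toℕ d ⌋ ∧ adj (K m) c d

  isEdge? : Decidable (T ∘ isEdge)
  isEdge? = T? ∘ isEdge

  edge⁺ : ∀ {c d} → toℕ c < toℕ d → (c , d) ∈ edges (K m)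
  edge⁺ {c} {d} c<d =
    ∈-filter⁺ isEdge? (∈-concat⁺′ (∈-map⁺ (c ,_) (∈-allFin d)) (∈-map⁺ _ (∈-allFin c)))
              (from T-∧ (fromWitness {a? = toℕ c <? toℕ d} c<d , adj-K λ { refl → <-irrefl refl c<d }))

  edge⁻ : ∀ {c d} → (c , d) ∈ edges (K m) → c ≢ d
  edge⁻ {c} cd∈ refl = <-irrefl refl (toWitness {a? = toℕ c <? toℕ c} c<c)
    where
    allPairs : List Move
    allPairs = concatMap (λ u → map (u ,_) (allFin m)) (allFin m)
    c<c : T ⌊ toℕ c <? toℕ c ⌋
    c<c = proj₁ (to T-∧ (proj₂ (∈-filter⁻ isEdge? {xs = allPairs} cd∈)))

  edge-between : ∀ {c d} → c ≢ d → (c , d) ∈ edges (K m) ⊎ (d , c) ∈ edges (K m)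
  edge-between {c} {d} c≢d with <-cmp (toℕ c) (toℕ d)
  ... | tri< c<d _ _ = inj₁ (edge⁺ c<d)
  ... | tri≈ _ c≡d _ = ⊥-elim (c≢d (toℕ-injective c≡d))
  ... | tri> _ _ d<c = inj₂ (edge⁺ d<c)

  uncovered≢covered : ∀ S {c x} → T (uncovered S c) → T (covered S x) → c ≢ x
  uncovered≢covered S uc cx refl = T-not⇒¬T uc cx

  touches-fst : ∀ a b d → T (inN (K m) (a , b) (a , d))
  touches-fst a b d rewrite ≡-≟-identity _≟_ {a} refl = _

  legal⁺ : ∀ S e {c d} → c ≢ d → T (uncovered S c) → T (uncovered S d) →
           T (inN (K m) e (c , d)) → T (legal (K m) S e)
  legal⁺ S e {c} {d} c≢d uc ud touch with edge-between c≢d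
  ... | inj₁ cd∈ = any⁺ _ (lose cd∈ (from T-∧ (touch , undominated⁺ S uc ud)))
  ... | inj₂ dc∈ =
    any⁺ _ (lose dc∈ (from T-∧ (subst T (inN-swapʳ (K m) e c d) touch , undominated⁺ S ud uc)))

  legal⁻ : ∀ S {a b} → T (legal (K m) S (a , b)) →
           2 ≤ #uncovered S × (T (uncovered S a) ⊎ T (uncovered S b))
  legal⁻ S {a} {b} lg with find (any⁻ _ (edges (K m)) lg)
  ... | (c , d) , cd∈ , p with to T-∧ p
  ...   | touch , undom with undominated⁻ S undom
  ...     | uc , ud = ∃₂⇒count≥2 (uncovered S) (edge⁻ cd∈) uc ud , endpoint (inN⁻ (K m) touch)
    where
    endpoint : (a ≡ c ⊎ a ≡ d) ⊎ (b ≡ c ⊎ b ≡ d) → T (uncovered S a) ⊎ T (uncovered S b)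
    endpoint (inj₁ (inj₁ a≡c)) = inj₁ (subst (T ∘ uncovered S) (sym a≡c) uc)
    endpoint (inj₁ (inj₂ a≡d)) = inj₁ (subst (T ∘ uncovered S) (sym a≡d) ud)
    endpoint (inj₂ (inj₁ b≡c)) = inj₂ (subst (T ∘ uncovered S) (sym b≡c) uc)
    endpoint (inj₂ (inj₂ b≡d)) = inj₂ (subst (T ∘ uncovered S) (sym b≡d) ud)

  legal-swap : ∀ S a b → legal (K m) S (a , b) ≡ legal (K m) S (b , a)
  legal-swap S a b = cong or (map-cong (λ f → cong (_∧ _) (inN-swapˡ (K m) a b f)) (edges (K m)))

  legalMove-between : ∀ S {c d} → c ≢ d → T (legal (K m) S (c , d)) →
                      ∃ λ e → e ∈ legalMoves (K m) S × #uncovered (e ∷ S) ≡ #uncovered ((c , d) ∷ S)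
  legalMove-between S {c} {d} c≢d lg with edge-between c≢d
  ... | inj₁ cd∈ = (c , d) , ∈-filter⁺ (T? ∘ legal (K m) S) cd∈ lg , refl
  ... | inj₂ dc∈ = (d , c) , ∈-filter⁺ (T? ∘ legal (K m) S) dc∈ (subst T (legal-swap S c d) lg) ,
                   #uncovered-swap S d c

  move-effect : ∀ S {e} → e ∈ legalMoves (K m) S →
                #uncovered S ≡ 2 + #uncovered (e ∷ S) ⊎ #uncovered S ≡ 1 + #uncovered (e ∷ S)
  move-effect S {a , b} e∈ with ∈-filter⁻ (T? ∘ legal (K m) S) e∈
  ... | ab∈ , lg with proj₂ (legal⁻ S lg) | T⊎T-not (covered S a) | T⊎T-not (covered S b)
  ...   | _       | inj₂ ua | inj₂ ub = inj₁ (#uncovered-cover₂ S (edge⁻ ab∈) ua ub)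
  ...   | _       | inj₂ ua | inj₁ cb = inj₂ (#uncovered-cover₁ S ua cb)
  ...   | _       | inj₁ ca | inj₂ ub =
    inj₂ (trans (#uncovered-cover₁ S ub ca) (cong suc (#uncovered-swap S b a)))
  ...   | inj₁ ua | inj₁ ca | inj₁ _  = ⊥-elim (T-not⇒¬T ua ca)
  ...   | inj₂ ub | inj₁ _  | inj₁ cb = ⊥-elim (T-not⇒¬T ub cb)

  double-move : ∀ S → 2 ≤ #uncovered S →
                ∃ λ e → e ∈ legalMoves (K m) S × #uncovered S ≡ 2 + #uncovered (e ∷ S)
  double-move S 2≤ with count≥2⇒∃₂ (uncovered S) 2≤
  ... | c , d , c≢d , uc , ud
    with legalMove-between S c≢d (legal⁺ S (c , d) c≢d uc ud (touches-fst c d d))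
  ...   | e , e∈ , same = e , e∈ , trans (#uncovered-cover₂ S c≢d uc ud) (cong (2 +_) (sym same))

  single-move : ∀ S {x} → T (covered S x) → 2 ≤ #uncovered S →
                ∃ λ e → e ∈ legalMoves (K m) S × #uncovered S ≡ 1 + #uncovered (e ∷ S)
  single-move S {x} cx 2≤ with count≥2⇒∃₂ (uncovered S) 2≤
  ... | c , d , c≢d , uc , ud
    with legalMove-between S (uncovered≢covered S uc cx)
                             (legal⁺ S (c , x) c≢d uc ud (touches-fst c x d))
  ...   | e , e∈ , same = e , e∈ , trans (#uncovered-cover₁ S uc cx) (cong suc (sym same))

  game-over : ∀ S → #uncovered S ≤ 1 → legalMoves (K m) S ≡ []
  game-over S ≤1 = filter-none (T? ∘ legal (K m) S) {edges (K m)}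
    (All.tabulate λ {(a , b)} _ lg → ≤⇒≯ ≤1 (proj₁ (legal⁻ S {a} {b} lg)))

  valueAfter : ℕ → Bool → List Move → Move → ℕ
  valueAfter k d S e = reducedValue k d (#uncovered (e ∷ S))

  reducedValues : ℕ → Bool → List Move → List ℕ
  reducedValues k d S = map (valueAfter k d S) (legalMoves (K m) S)

  Dominator-step : ∀ k S {n} → #uncovered S ≡ 2 + n →
                   minimaxStep true (reducedValues k false S) ≡ suc (reducedValue k false n)
  Dominator-step k S {n} eq = minimaxStep-min _ best∈ (All.map⁺ (All.tabulate best≤))
    where
    best∈ : reducedValue k false n ∈ reducedValues k false S
    best∈ with double-move S (subst (2 ≤_) (sym eq) (s≤s (s≤s z≤n)))
    ... | e , e∈ , drop =
      subst (_∈ _) (cong (reducedValue k false) (+-cancelˡ-≡ 2 _ _ (trans (sym drop) eq)))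
            (∈-map⁺ (valueAfter k false S) e∈)
    best≤ : ∀ {e} → e ∈ legalMoves (K m) S → reducedValue k false n ≤ valueAfter k false S e
    best≤ e∈ with move-effect S e∈
    ... | inj₁ drop rewrite +-cancelˡ-≡ 2 _ _ (trans (sym drop) eq) = ≤-refl
    ... | inj₂ drop rewrite +-cancelˡ-≡ 1 _ _ (trans (sym drop) eq) = reducedValue-mono k false n

  Staller-step : ∀ k S {x n} → T (covered S x) → #uncovered S ≡ 2 + n →
                 minimaxStep false (reducedValues k true S) ≡ suc (reducedValue k true (1 + n))
  Staller-step k S {n = n} cx eq = minimaxStep-max _ best∈ (All.map⁺ (All.tabulate ≤best))
    where
    best∈ : reducedValue k true (1 + n) ∈ reducedValues k true S
    best∈ with single-move S cx (subst (2 ≤_) (sym eq) (s≤s (s≤s z≤n)))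
    ... | e , e∈ , drop =
      subst (_∈ _) (cong (reducedValue k true) (+-cancelˡ-≡ 1 _ _ (trans (sym drop) eq)))
            (∈-map⁺ (valueAfter k true S) e∈)
    ≤best : ∀ {e} → e ∈ legalMoves (K m) S → valueAfter k true S e ≤ reducedValue k true (1 + n)
    ≤best e∈ with move-effect S e∈
    ... | inj₁ drop rewrite +-cancelˡ-≡ 2 _ _ (trans (sym drop) eq) = reducedValue-mono k true n
    ... | inj₂ drop rewrite +-cancelˡ-≡ 1 _ _ (trans (sym drop) eq) = ≤-refl

  -- The hypothesis lets Staller cover a single vertex; it holds after any move.
  value≡reducedValue : ∀ k dom S → (dom ≡ false → ∃ (T ∘ covered S)) →
                       value (K m) k dom S ≡ reducedValue k dom (#uncovered S)
  value≡reducedValue zero    dom S _          = refl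
  value≡reducedValue (suc k) dom S somePlayed = begin
    value (K m) (suc k) dom S                      ≡⟨ value-unfold (K m) k dom S ⟩
    minimaxStep dom (map next (legalMoves (K m) S)) ≡⟨ cong (minimaxStep dom) (map-cong next≡ _) ⟩
    minimaxStep dom (reducedValues k (not dom) S)  ≡⟨ step dom somePlayed (#uncovered S) refl ⟩
    reducedValue (suc k) dom (#uncovered S)        ∎
    where
    open ≡-Reasoning
    next : Move → ℕ
    next e = value (K m) k (not dom) (e ∷ S)
    next≡ : ∀ e → next e ≡ valueAfter k (not dom) S e
    next≡ (a , b) = value≡reducedValue k (not dom) ((a , b) ∷ S) λ _ → a , covered-fst S a b
    step : ∀ d → (d ≡ false → ∃ (T ∘ covered S)) → ∀ n → #uncovered S ≡ n →
           minimaxStep d (reducedValues k (not d) S) ≡ reducedValue (suc k) d n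
    step d     _          zero          eq rewrite game-over S (subst (_≤ 1) (sym eq) z≤n) = refl
    step d     _          (suc zero)    eq rewrite game-over S (≤-reflexive eq) = refl
    step true  _          (suc (suc n)) eq = Dominator-step k S eq
    step false somePlayed (suc (suc n)) eq = Staller-step k S (proj₂ (somePlayed refl)) eq

m≤1+#edges : ∀ m → m ≤ suc (length (edges (K m)))
m≤1+#edges zero    = z≤n
m≤1+#edges (suc m) = s≤s (begin
  m                                       ≡⟨ length-tabulate Fin.suc ⟨
  length (tabulate {n = m} Fin.suc)       ≡⟨ length-map _ (tabulate {n = m} Fin.suc) ⟨
  length firstRow                         ≡⟨ cong length (filter-all isEdge? firstRow-edges) ⟨
  length (filter isEdge? firstRow)        ≤⟨ m≤m+n _ _ ⟩
  length (filter isEdge? firstRow) + length (filter isEdge? otherRows)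
                                          ≡⟨ length-++ (filter isEdge? firstRow) ⟨
  length (filter isEdge? firstRow ++ filter isEdge? otherRows)
                                          ≡⟨ cong length (filter-++ isEdge? firstRow otherRows) ⟨
  length (edges (K (suc m)))              ∎)
  where
  open ≤-Reasoning
  open Complete (suc m) using (Move; isEdge; isEdge?)
  firstRow otherRows : List Move
  firstRow  = map (Fin.zero ,_) (tabulate Fin.suc)
  otherRows = concat (map (λ u → map (u ,_) (allFin (suc m))) (tabulate Fin.suc))
  firstRow-edges : All.All (T ∘ isEdge) firstRow
  firstRow-edges = All.map⁺ (All.tabulate⁺ λ _ → _)

theorem1 : (m : ℕ) → m ≥ 1 → γeg (K m) ≡ ⌈ 2 * m /3⌉ ∸ 1
theorem1 m _ = begin
  γeg (K m)                            ≡⟨ value≡reducedValue _ true [] (λ ()) ⟩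
  reducedValue _ true (#uncovered [])  ≡⟨ cong (reducedValue _ true) (count-true m) ⟩
  reducedValue _ true m                ≡⟨ reducedValue≡closedForm _ true m (m≤1+#edges m) ⟩
  ⌈ 2 * m /3⌉ ∸ 1                      ∎
  where
  open ≡-Reasoning
  open Complete m
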